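{- Let $a,b\ge 2$ be integers, let $n\ge 5$, and let $r=a$ if $n$ is even and $r=b$ if $n$ is odd. Then $f_{(a,b,n)}$ has the word $f_{(a,b,n-1)}^{r-2}f_{(a,b,n-2)}$ as a suffix, and $t_{(a,b,n)}$ has the same word $f_{(a,b,n-1)}^{r-2}f_{(a,b,n-2)}$ as a prefix.
   Context: Words are over the alphabet $\{0,1\}$, with concatenation as the product; $w^k$ denotes the concatenation of $k$ copies of $w$ ($w^0$ is the empty word). For integers $a,b\ge 1$ the biperiodic Fibonacci words are defined by $f_{(a,b,0)}=0$, $f_{(a,b,1)}=0^{a-1}1$, and for $n\ge 2$: $f_{(a,b,n)} = f_{(a,b,n-1)}^{a}f_{(a,b,n-2)}$ if $n$ is even, and $f_{(a,b,n)} = f_{(a,b,n-1)}^{b}f_{(a,b,n-2)}$ if $n$ is odd. For a word $f_{(a,b,n)}$ with at least two letters, write $f_{(a,b,n)} = p\,xy$ with $x,y$ letters; then $t_{(a,b,n)} := p\,yx$ is $f_{(a,b,n)}$ with its last two letters interchanged. -}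

module Defs where

open import Data.Nat using (ℕ; zero; suc; _∸_)
open import Data.Bool using (Bool; true; false)
open import Data.List using (List; []; _∷_; _++_)
open import Data.Product using (_×_; _,_; proj₁; proj₂)

data Letter : Set where
  𝟎 𝟏 : Letter

Word : Set
Word = List Letter

_^ʷ_ : Word → ℕ → Word
w ^ʷ zero = []
w ^ʷ suc k = w ++ (w ^ʷ k)

even? : ℕ → Bool
even? zero = true
even? (suc n) with even? n
... | true = false
... | false = true

expo : ℕ → ℕ → ℕ → ℕ
expo a b n with even? n
... | true = a
... | false = b

-- fibPair a b n = (f_(a,b,n) , f_(a,b,n+1))
fibPair : ℕ → ℕ → ℕ → Word × Word
fibPair a b zero = (𝟎 ∷ []) , ((𝟎 ∷ []) ^ʷ (a ∸ 1)) ++ (𝟏 ∷ [])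
fibPair a b (suc n) with fibPair a b n
... | (p , q) = q , ((q ^ʷ expo a b (suc (suc n))) ++ p)

fib : ℕ → ℕ → ℕ → Word
fib a b n = proj₁ (fibPair a b n)

swapLast2 : Word → Word
swapLast2 [] = []
swapLast2 (x ∷ []) = x ∷ []
swapLast2 (x ∷ y ∷ []) = y ∷ x ∷ []
swapLast2 (x ∷ y ∷ z ∷ w) = x ∷ swapLast2 (y ∷ z ∷ w)

tword : ℕ → ℕ → ℕ → Word
tword a b n = swapLast2 (fib a b n)

-- Write A = f(n-1), B = f(n-2) and r for the exponent, so that f(n) = A^r B with r ≥ 2.
-- The suffix A^(r-2) B is immediate.  For the prefix, A itself begins with B, say A = B C,
-- hence f(n) = A^(r-2) A A B = (A^(r-2) B) (C A B); interchanging the last two letters only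
-- affects the factor C A B, which has at least two letters because A and B are nonempty.
module Submission where

open import Defs
open import Data.Nat using (ℕ; zero; suc; _+_; _≤_; _∸_; s≤s; z≤n)
open import Data.Nat.Properties using (≤-trans; +-comm; m∸n+n≡m; m∸n≤m; +-mono-≤)
open import Data.Bool using (true; false)
open import Data.List using ([]; _∷_; _++_; length)
open import Data.List.Properties using (++-assoc; ++-monoid; length-++; length-++-≤ˡ; length-++-≤ʳ)
open import Tactic.MonoidSolver using (solve)
open import Data.Product using (_×_; ∃; _,_; map₂)
open import Relation.Binary.PropositionalEquality using (_≡_; refl; sym; trans; cong; subst)
open Relation.Binary.PropositionalEquality.≡-Reasoning

^ʷ-+ : (A : Word) (m k : ℕ) → A ^ʷ (m + k) ≡ (A ^ʷ m) ++ (A ^ʷ k)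
^ʷ-+ A zero    k = refl
^ʷ-+ A (suc m) k = begin
  A ++ (A ^ʷ (m + k))          ≡⟨ cong (A ++_) (^ʷ-+ A m k) ⟩
  A ++ (A ^ʷ m) ++ (A ^ʷ k)    ≡⟨ sym (++-assoc A (A ^ʷ m) (A ^ʷ k)) ⟩
  (A ++ (A ^ʷ m)) ++ (A ^ʷ k)  ∎

^ʷ-++-startsWith : (A D : Word) {r : ℕ} → 1 ≤ r → ∃ λ C → (A ^ʷ r) ++ D ≡ A ++ C
^ʷ-++-startsWith A D {suc r} _ = (A ^ʷ r) ++ D , ++-assoc A (A ^ʷ r) D

^ʷ-++-suffix : (A B : Word) {j r : ℕ} → j ≤ r → ∃ λ u → (A ^ʷ r) ++ B ≡ u ++ (A ^ʷ j) ++ B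
^ʷ-++-suffix A B {j} {r} j≤r = A ^ʷ (r ∸ j) , (begin
  (A ^ʷ r) ++ B                          ≡⟨ cong (λ e → (A ^ʷ e) ++ B) (sym (m∸n+n≡m j≤r)) ⟩
  (A ^ʷ (r ∸ j + j)) ++ B                ≡⟨ cong (_++ B) (^ʷ-+ A (r ∸ j) j) ⟩
  ((A ^ʷ (r ∸ j)) ++ (A ^ʷ j)) ++ B      ≡⟨ ++-assoc (A ^ʷ (r ∸ j)) (A ^ʷ j) B ⟩
  (A ^ʷ (r ∸ j)) ++ (A ^ʷ j) ++ B        ∎)

swapLast2-∷ : (x : Letter) (w : Word) → 2 ≤ length w → swapLast2 (x ∷ w) ≡ x ∷ swapLast2 w
swapLast2-∷ x (y ∷ [])    (s≤s ())
swapLast2-∷ x (y ∷ z ∷ w) _ = refl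

swapLast2-++ : (u w : Word) → 2 ≤ length w → swapLast2 (u ++ w) ≡ u ++ swapLast2 w
swapLast2-++ []      w 2≤∣w∣ = refl
swapLast2-++ (x ∷ u) w 2≤∣w∣ = begin
  swapLast2 (x ∷ u ++ w)  ≡⟨ swapLast2-∷ x (u ++ w) (≤-trans 2≤∣w∣ (length-++-≤ʳ w {u})) ⟩
  x ∷ swapLast2 (u ++ w)  ≡⟨ cong (x ∷_) (swapLast2-++ u w 2≤∣w∣) ⟩
  x ∷ u ++ swapLast2 w    ∎

swapLast2-^ʷ-++-prefix : (A B C : Word) {r : ℕ} → A ≡ B ++ C → 1 ≤ length B → 2 ≤ r →
  ∃ λ v → swapLast2 ((A ^ʷ r) ++ B) ≡ ((A ^ʷ (r ∸ 2)) ++ B) ++ v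
swapLast2-^ʷ-++-prefix .(B ++ C) B C {suc (suc k)} refl 1≤∣B∣ (s≤s (s≤s _)) =
  swapLast2 (C ++ A ++ B) , (begin
  swapLast2 ((A ^ʷ (2 + k)) ++ B)             ≡⟨ cong swapLast2 split ⟩
  swapLast2 (((A ^ʷ k) ++ B) ++ C ++ A ++ B)  ≡⟨ swapLast2-++ ((A ^ʷ k) ++ B) (C ++ A ++ B) 2≤∣CAB∣ ⟩
  ((A ^ʷ k) ++ B) ++ swapLast2 (C ++ A ++ B)  ∎)
  where
  A : Word
  A = B ++ C
  split : (A ^ʷ (2 + k)) ++ B ≡ ((A ^ʷ k) ++ B) ++ C ++ A ++ B
  split = begin
    (A ^ʷ (2 + k)) ++ B               ≡⟨ cong (λ e → (A ^ʷ e) ++ B) (+-comm 2 k) ⟩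
    (A ^ʷ (k + 2)) ++ B               ≡⟨ cong (_++ B) (^ʷ-+ A k 2) ⟩
    ((A ^ʷ k) ++ A ++ A ++ []) ++ B   ≡⟨ solve (++-monoid Letter) ⟩
    ((A ^ʷ k) ++ B) ++ C ++ A ++ B    ∎
  2≤∣CAB∣ : 2 ≤ length (C ++ A ++ B)
  2≤∣CAB∣ = ≤-trans (+-mono-≤ (≤-trans 1≤∣B∣ (length-++-≤ˡ B)) 1≤∣B∣)
                    (subst (_≤ length (C ++ A ++ B)) (length-++ A) (length-++-≤ʳ (A ++ B) {C}))

fib-step : (a b k : ℕ) → fib a b (2 + k) ≡ (fib a b (1 + k) ^ʷ expo a b (2 + k)) ++ fib a b k
fib-step a b k with fibPair a b k
... | p , q = refl

fib-nonempty : (a b k : ℕ) → 1 ≤ length (fib a b k)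
fib-nonempty a b zero          = s≤s z≤n
fib-nonempty a b (suc zero)    = length-++-≤ʳ (𝟏 ∷ []) {(𝟎 ∷ []) ^ʷ (a ∸ 1)}
fib-nonempty a b (suc (suc k)) = subst (λ w → 1 ≤ length w) (sym (fib-step a b k))
  (≤-trans (fib-nonempty a b k) (length-++-≤ʳ (fib a b k) {fib a b (1 + k) ^ʷ expo a b (2 + k)}))

expo-≥2 : {a b : ℕ} → 2 ≤ a → 2 ≤ b → (n : ℕ) → 2 ≤ expo a b n
expo-≥2 2≤a 2≤b n with even? n
... | true  = 2≤a
... | false = 2≤b

fib-startsWith : {a b : ℕ} → 2 ≤ a → 2 ≤ b → (k : ℕ) → ∃ λ C → fib a b (2 + k) ≡ fib a b (1 + k) ++ C
fib-startsWith {a} {b} 2≤a 2≤b k = map₂ (trans (fib-step a b k))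
  (^ʷ-++-startsWith (fib a b (1 + k)) (fib a b k) (≤-trans (s≤s z≤n) (expo-≥2 2≤a 2≤b (2 + k))))

mainTheorem2 : (a b n : ℕ) → 2 ≤ a → 2 ≤ b → 5 ≤ n →
    let r = expo a b n
        s = (fib a b (n ∸ 1) ^ʷ (r ∸ 2)) ++ fib a b (n ∸ 2)
    in (∃ λ u → fib a b n ≡ u ++ s) × (∃ λ v → tword a b n ≡ s ++ v)
mainTheorem2 a b (suc (suc (suc k))) 2≤a 2≤b (s≤s (s≤s (s≤s _))) with fib-startsWith 2≤a 2≤b k
... | C , A≡BC =
  map₂ (trans fibₙ) (^ʷ-++-suffix A B (m∸n≤m r 2)) ,
  map₂ (trans (cong swapLast2 fibₙ))
       (swapLast2-^ʷ-++-prefix A B C A≡BC (fib-nonempty a b (1 + k)) (expo-≥2 2≤a 2≤b (3 + k)))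
  where
  A B : Word
  A = fib a b (2 + k)
  B = fib a b (1 + k)
  r : ℕ
  r = expo a b (3 + k)
  fibₙ : fib a b (3 + k) ≡ (A ^ʷ r) ++ B
  fibₙ = fib-step a b (1 + k)
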